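{- Let $n$ be odd and $q=2^n$. In the plane $\Pi(\mathbb{K}_n^{td})$ the set of lines $$\mathcal{L}_c=\{l_{m+\sqrt{m},\,m}: m\in\mathbb{F}_q\}\cup\{l_0,l_1\}$$ is a line hyperoval, where $\sqrt{m}=m^{2^{n-1}}$.
   Context: $\mathrm{Tr}:\mathbb{F}_q\to\mathbb{F}_2$ is the absolute trace. $\mathbb{K}_n^{td}=(\mathbb{F}_q,+,\circ)$ ($n$ odd) is the presemifield with $x\circ y=xy+\mathrm{Tr}(x)\,y^{2^{n-1}}+\mathrm{Tr}(x^2y)$. The plane $\Pi(\mathbb{K}_n^{td})$ has affine points $(a,b)$, points at infinity $(a)$, $a\in\mathbb{F}_q\cup\{\infty\}$, and lines: $l_\infty$ (the line at infinity); $l_a=\{(a,y):y\in\mathbb{F}_q\}\cup\{(\infty)\}$ for $a\in\mathbb{F}_q$; $l_{a,b}=\{(x,y):y=x\circ a+b\}\cup\{(a)\}$ for $a,b\in\mathbb{F}_q$. A line hyperoval is a set of $q+2$ lines no three of which are concurrent. -}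

module Defs where

open import Level using (0ℓ)
open import Data.Nat as ℕ using (ℕ; zero; suc; _∸_; _%_)
open import Data.Fin using (Fin)
import Data.Fin as Fin
open import Data.Empty using (⊥)
open import Data.Unit using (⊤)
open import Data.Sum using (_⊎_; inj₁; inj₂)
open import Data.Product using (Σ; ∃; _×_; _,_)
open import Data.Maybe using (Maybe; just; nothing)
open import Relation.Binary.PropositionalEquality using (_≡_; _≢_)
open import Relation.Nullary using (¬_)
open import Algebra.Structures using (IsCommutativeRing)
open import Function.Bundles using (_⤖_)
open import Function.Definitions using (Injective)

-- A finite field with exactly 2^n elements (hence F_q, q = 2^n, unique up to
-- isomorphism), with propositional equality.
record FiniteField (n : ℕ) : Set₁ where
  infixl 6 _+_
  infixl 7 _*_
  field
    F     : Set
    _+_   : F → F → F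
    _*_   : F → F → F
    -_    : F → F
    0#    : F
    1#    : F
    isCommutativeRing : IsCommutativeRing _≡_ _+_ _*_ -_ 0# 1#
    1≢0   : 1# ≢ 0#
    inverse : ∀ x → x ≢ 0# → Σ F (λ y → x * y ≡ 1#)
    card  : F ⤖ Fin (2 ℕ.^ n)

  _^_ : F → ℕ → F
  x ^ zero  = 1#
  x ^ suc k = x * (x ^ k)

  -- Absolute trace Tr(x) = Σ_{i<n} x^(2^i), viewed as an element of F_q
  -- (its value lies in the prime field {0,1}).
  trAux : ℕ → F → F
  trAux zero    x = 0#
  trAux (suc i) x = (x ^ (2 ℕ.^ i)) + trAux i x

  Tr : F → F
  Tr x = trAux n x

  sqrt : F → F
  sqrt m = m ^ (2 ℕ.^ (n ∸ 1))

  _∘_ : F → F → F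
  x ∘ y = x * y + Tr x * (y ^ (2 ℕ.^ (n ∸ 1))) + Tr ((x ^ 2) * y)

  data Point : Set where
    affine : F → F → Point
    atInf  : Maybe F → Point        -- (a), with nothing standing for (∞)

  data Line : Set where
    l∞   : Line
    lV   : F → Line
    lAB  : F → F → Line

  _∈L_ : Point → Line → Set
  affine x y     ∈L l∞      = ⊥
  atInf _        ∈L l∞      = ⊤
  affine x y     ∈L lV a    = x ≡ a
  atInf nothing  ∈L lV a    = ⊤
  atInf (just _) ∈L lV a    = ⊥
  affine x y     ∈L lAB a b = y ≡ (x ∘ a) + b
  atInf nothing  ∈L lAB a b = ⊥
  atInf (just c) ∈L lAB a b = c ≡ a

  -- A line hyperoval given as a family of lines indexed by a set I:
  -- I has exactly q+2 elements, the family is injective (so it is a set of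
  -- q+2 lines), and no three distinct lines of it are concurrent.
  record IsLineHyperoval {I : Set} (L : I → Line) : Set where
    field
      size       : I ⤖ Fin (2 ℕ.^ n ℕ.+ 2)
      distinct   : Injective _≡_ _≡_ L
      noThree    : ∀ i j k → i ≢ j → j ≢ k → i ≢ k →
                   ¬ Σ Point (λ P → (P ∈L L i) × (P ∈L L j) × (P ∈L L k))

  ℒc : F ⊎ Fin 2 → Line
  ℒc (inj₁ m)        = lAB (m + sqrt m) m
  ℒc (inj₂ Fin.zero) = lV 0#
  ℒc (inj₂ (Fin.suc _)) = lV 1#

module Submission where

-- A line l_{m+√m, m} of ℒc meets l∞ in (m + √m) and the vertical line x = c in the affine
-- point (c, c ∘ (m + √m) + m).  Both m ↦ m + √m and m ↦ c ∘ (m + √m) + m are additive, so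
-- three concurrent lines would give an additive map with two distinct nonzero roots.  The
-- first map has kernel {0, 1}.  For the second, write a root as s⁴: if Tr c = 0 the root
-- satisfies (c + 1) s² = c, and if Tr c = 1 then s + Tr (c s² + c s) is a nonzero root of
-- (c + 1) X⁴ + (c + 1) X² + X, a polynomial that has two distinct nonzero roots a, b only
-- if its coefficient y has trace 1, because then v = y (a³ + a b² + b³) solves
-- v² + v = y² + 1.  The vertical lines l_0 and l_1 are disposed of by c = 0 giving the
-- identity and, since Tr 1 = 1 for n odd, c = 1 giving an injective map.

open import Level using (0ℓ)
open import Data.Empty using (⊥; ⊥-elim)
open import Data.Fin using (Fin; zero; suc; punchIn)
import Data.Fin.Properties as Finₚ
open import Data.Maybe using (just; nothing)
open import Data.Nat as ℕ using (ℕ; zero; suc; _%_)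
import Data.Nat.Properties as ℕₚ
open import Data.Product using (Σ; ∃; _×_; _,_; proj₁; proj₂)
open import Data.Sum using (_⊎_; inj₁; inj₂; [_,_]′)
open import Data.Sum.Function.Propositional using (_⊎-↔_)
open import Function using (_∘′_)
open import Function.Bundles using (_⤖_; _↔_; mk↔ₛ′; Inverse)
open import Function.Construct.Composition using (_↔-∘_)
open import Function.Construct.Identity using (↔-id)
open import Function.Construct.Symmetry using (↔-sym)
open import Function.Definitions using (Injective)
open import Function.Properties.Bijection using (⤖⇒↔)
open import Function.Properties.Inverse using (↔⇒⤖)
open import Relation.Nullary using (¬_; yes; no)
open import Relation.Nullary.Decidable using (map′)
open import Relation.Binary.Definitions using (DecidableEquality)
open import Relation.Binary.PropositionalEquality
open import Algebra.Bundles using (CommutativeRing)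
open import Algebra.Structures using (IsCommutativeRing)
import Algebra.Properties.CommutativeMonoid.Sum as MonoidSum
import Algebra.Properties.Ring

open import Defs

module FieldProperties {n : ℕ} (K : FiniteField n) where
  open FiniteField K
  open IsCommutativeRing isCommutativeRing
    using (*-comm; *-assoc; *-identityˡ; *-identityʳ; zeroˡ; zeroʳ)
  open ≡-Reasoning

  commutativeRing : CommutativeRing 0ℓ 0ℓ
  commutativeRing = record { isCommutativeRing = isCommutativeRing }

  open import Algebra.Solver.Ring.NaturalCoefficients.Default
    (CommutativeRing.commutativeSemiring commutativeRing)

  infix 8 _²
  _² : F → F
  x ² = x * x

  q : ℕ
  q = 2 ℕ.^ n

  card↔ : F ↔ Fin q
  card↔ = ⤖⇒↔ card

  open Inverse card↔ using (to; from; strictlyInverseˡ; strictlyInverseʳ)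

  infix 4 _≟_
  _≟_ : DecidableEquality F
  x ≟ y = map′ to-injective (cong to) (to x Finₚ.≟ to y)
    where
    to-injective : to x ≡ to y → x ≡ y
    to-injective e = begin
      x           ≡⟨ sym (strictlyInverseʳ x) ⟩
      from (to x) ≡⟨ cong from e ⟩
      from (to y) ≡⟨ strictlyInverseʳ y ⟩
      y           ∎

  module _ {x : F} (x≢0 : x ≢ 0#) where
    private
      x⁻¹ : F
      x⁻¹ = proj₁ (inverse x x≢0)

      cancel : ∀ y → x⁻¹ * (x * y) ≡ y
      cancel y = begin
        x⁻¹ * (x * y) ≡⟨ solve 3 (λ i x y → i :* (x :* y) := (x :* i) :* y) refl x⁻¹ x y ⟩
        (x * x⁻¹) * y ≡⟨ cong (_* y) (proj₂ (inverse x x≢0)) ⟩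
        1# * y        ≡⟨ *-identityˡ y ⟩
        y             ∎

      uncancel : ∀ y → x * (x⁻¹ * y) ≡ y
      uncancel y = trans (solve 3 (λ x i y → x :* (i :* y) := i :* (x :* y)) refl x x⁻¹ y) (cancel y)

    *-cancelˡ : ∀ {y z} → x * y ≡ x * z → y ≡ z
    *-cancelˡ {y} {z} xy≡xz = begin
      y             ≡⟨ sym (cancel y) ⟩
      x⁻¹ * (x * y) ≡⟨ cong (x⁻¹ *_) xy≡xz ⟩
      x⁻¹ * (x * z) ≡⟨ cancel z ⟩
      z             ∎

    x*y≡0⇒y≡0 : ∀ {y} → x * y ≡ 0# → y ≡ 0#
    x*y≡0⇒y≡0 {y} xy≡0 = *-cancelˡ (trans xy≡0 (sym (zeroʳ x)))

    *-↔ : F ↔ F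
    *-↔ = mk↔ₛ′ (x *_) (x⁻¹ *_) uncancel cancel

  *-cancelʳ : ∀ {x y z} → z ≢ 0# → x * z ≡ y * z → x ≡ y
  *-cancelʳ {x} {y} {z} z≢0 xz≡yz = *-cancelˡ z≢0 (trans (*-comm z x) (trans xz≡yz (*-comm y z)))

  x*y≢0 : ∀ {x y} → x ≢ 0# → y ≢ 0# → x * y ≢ 0#
  x*y≢0 x≢0 y≢0 xy≡0 = y≢0 (x*y≡0⇒y≡0 x≢0 xy≡0)

  ^-distribˡ-+-* : ∀ x a b → x ^ (a ℕ.+ b) ≡ x ^ a * x ^ b
  ^-distribˡ-+-* x zero    b = sym (*-identityˡ _)
  ^-distribˡ-+-* x (suc a) b = trans (cong (x *_) (^-distribˡ-+-* x a b)) (sym (*-assoc _ _ _))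

  ^-distribʳ-* : ∀ x y a → (x * y) ^ a ≡ x ^ a * y ^ a
  ^-distribʳ-* x y zero    = sym (*-identityˡ 1#)
  ^-distribʳ-* x y (suc a) = trans (cong ((x * y) *_) (^-distribʳ-* x y a))
    (solve 4 (λ x y u v → (x :* y) :* (u :* v) := (x :* u) :* (y :* v)) refl x y (x ^ a) (y ^ a))

  1^a≡1 : ∀ a → 1# ^ a ≡ 1#
  1^a≡1 zero    = refl
  1^a≡1 (suc a) = trans (cong (1# *_) (1^a≡1 a)) (*-identityˡ 1#)

  x^2^[1+k]≡[x^2^k]² : ∀ x k → x ^ (2 ℕ.^ suc k) ≡ (x ^ (2 ℕ.^ k)) ²
  x^2^[1+k]≡[x^2^k]² x k = begin
    x ^ (2 ℕ.^ k ℕ.+ (2 ℕ.^ k ℕ.+ 0)) ≡⟨ cong (λ j → x ^ (2 ℕ.^ k ℕ.+ j)) (ℕₚ.+-identityʳ (2 ℕ.^ k)) ⟩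
    x ^ (2 ℕ.^ k ℕ.+ 2 ℕ.^ k)         ≡⟨ ^-distribˡ-+-* x (2 ℕ.^ k) (2 ℕ.^ k) ⟩
    (x ^ (2 ℕ.^ k)) ²                  ∎

  0^2^k≡0 : ∀ k → 0# ^ (2 ℕ.^ k) ≡ 0#
  0^2^k≡0 zero    = zeroˡ 1#
  0^2^k≡0 (suc k) = trans (x^2^[1+k]≡[x^2^k]² 0# k) (trans (cong _² (0^2^k≡0 k)) (zeroˡ 0#))

  private
    module Product = MonoidSum (CommutativeRing.*-commutativeMonoid commutativeRing)

  ∏ : (F → F) → F
  ∏ f = Product.sum {q} (f ∘′ from)

  ∏-cong : ∀ {f g} → (∀ y → f y ≡ g y) → ∏ f ≡ ∏ g
  ∏-cong f≗g = Product.sum-cong-≗ (λ i → f≗g (from i))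

  ∏-* : ∀ f g → ∏ (λ y → f y * g y) ≡ ∏ f * ∏ g
  ∏-* f g = Product.∑-distrib-+ (f ∘′ from) (g ∘′ from)

  ∏-const : ∀ c → ∏ (λ _ → c) ≡ c ^ q
  ∏-const c = power q
    where
    power : ∀ k → Product.sum {k} (λ _ → c) ≡ c ^ k
    power zero    = refl
    power (suc k) = cong (c *_) (power k)

  ∏-nonzero : ∀ {f} → (∀ y → f y ≢ 0#) → ∏ f ≢ 0#
  ∏-nonzero {f} f≢0 = nonzero q (f ∘′ from) (λ i → f≢0 (from i))
    where
    nonzero : ∀ k (g : Fin k → F) → (∀ i → g i ≢ 0#) → Product.sum g ≢ 0#
    nonzero zero    g g≢0 = 1≢0
    nonzero (suc k) g g≢0 = x*y≢0 (g≢0 zero) (nonzero k (g ∘′ suc) (λ i → g≢0 (suc i)))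

  ∏-single : ∀ {f} z → (∀ y → y ≢ z → f y ≡ 1#) → ∏ f ≡ f z
  ∏-single {f} z f≡1 = trans (single (f ∘′ from) (to z) rest≡1) (cong f (strictlyInverseʳ z))
    where
    single : ∀ {k} (g : Fin k → F) i → (∀ j → j ≢ i → g j ≡ 1#) → Product.sum g ≡ g i
    single {suc k} g i g≡1 = begin
      Product.sum g                      ≡⟨ Product.sum-remove g ⟩
      g i * Product.sum (g ∘′ punchIn i) ≡⟨ cong (g i *_) rest ⟩
      g i * 1#                           ≡⟨ *-identityʳ (g i) ⟩
      g i                                ∎
      where
      rest : Product.sum (g ∘′ punchIn i) ≡ 1#
      rest = trans (Product.sum-cong-≗ (λ j → g≡1 _ (Finₚ.punchInᵢ≢i i j))) (Product.sum-replicate-zero k)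

    rest≡1 : ∀ j → j ≢ to z → f (from j) ≡ 1#
    rest≡1 j j≢z = f≡1 _ (λ e → j≢z (trans (sym (strictlyInverseˡ j)) (cong to e)))

  ∏-reindex : ∀ {x} → x ≢ 0# → ∀ f → ∏ (λ y → f (x * y)) ≡ ∏ f
  ∏-reindex {x} x≢0 f = sym (begin
    ∏ f                                                 ≡⟨ Product.∑-permute (f ∘′ from) π ⟩
    Product.sum {q} (λ i → f (from (to (x * from i))))
      ≡⟨ Product.sum-cong-≗ (λ i → cong f (strictlyInverseʳ (x * from i))) ⟩
    ∏ (λ y → f (x * y))                                 ∎)
    where
    π : Fin q ↔ Fin q
    π = card↔ ↔-∘ (*-↔ x≢0 ↔-∘ ↔-sym card↔)

  unit : F → F
  unit y with y ≟ 0#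
  ... | yes _ = 1#
  ... | no  _ = y

  unit≢0 : ∀ y → unit y ≢ 0#
  unit≢0 y with y ≟ 0#
  ... | yes _   = 1≢0
  ... | no  y≢0 = y≢0

  atZero : F → F → F
  atZero c y with y ≟ 0#
  ... | yes _ = c
  ... | no  _ = 1#

  ∏-atZero : ∀ c → ∏ (atZero c) ≡ c
  ∏-atZero c = trans (∏-single 0# atZero≡1) atZero[0]≡c
    where
    atZero≡1 : ∀ y → y ≢ 0# → atZero c y ≡ 1#
    atZero≡1 y y≢0 with y ≟ 0#
    ... | yes y≡0 = ⊥-elim (y≢0 y≡0)
    ... | no  _   = refl

    atZero[0]≡c : atZero c 0# ≡ c
    atZero[0]≡c with 0# ≟ 0#
    ... | yes _   = refl
    ... | no  0≢0 = ⊥-elim (0≢0 refl)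

  unit[xy]*atZero≡x*unit[y] : ∀ {x} → x ≢ 0# → ∀ y → unit (x * y) * atZero x y ≡ x * unit y
  unit[xy]*atZero≡x*unit[y] {x} x≢0 y with y ≟ 0# | x * y ≟ 0#
  ... | yes refl | yes _    = trans (*-identityˡ x) (sym (*-identityʳ x))
  ... | yes refl | no xy≢0  = ⊥-elim (xy≢0 (zeroʳ x))
  ... | no  y≢0  | yes xy≡0 = ⊥-elim (x*y≢0 x≢0 y≢0 xy≡0)
  ... | no  _    | no  _    = *-identityʳ (x * y)

  -- Reindexing ∏ unit along y ↦ x * y multiplies it by x ^ q, up to the factor x lost at y = 0.
  fermat : ∀ x → x ^ q ≡ x
  fermat x with x ≟ 0#
  ... | yes refl = 0^2^k≡0 n
  ... | no x≢0 = *-cancelʳ (∏-nonzero unit≢0) (begin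
    x ^ q * ∏ unit                         ≡⟨ cong (_* ∏ unit) (sym (∏-const x)) ⟩
    ∏ (λ _ → x) * ∏ unit                   ≡⟨ sym (∏-* (λ _ → x) unit) ⟩
    ∏ (λ y → x * unit y)                   ≡⟨ sym (∏-cong (unit[xy]*atZero≡x*unit[y] x≢0)) ⟩
    ∏ (λ y → unit (x * y) * atZero x y)    ≡⟨ ∏-* (λ y → unit (x * y)) (atZero x) ⟩
    ∏ (λ y → unit (x * y)) * ∏ (atZero x)  ≡⟨ cong₂ _*_ (∏-reindex x≢0 unit) (∏-atZero x) ⟩
    ∏ unit * x                             ≡⟨ *-comm _ x ⟩
    x * ∏ unit                             ∎)

module Characteristic2 {n : ℕ} (K : FiniteField (suc n)) where
  open FiniteField K
  open FieldProperties K
  open IsCommutativeRing isCommutativeRing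
    using (+-assoc; +-identityˡ; +-identityʳ; *-identityʳ; zeroˡ; zeroʳ; distribʳ; -‿inverseʳ)
  open ≡-Reasoning
  open import Algebra.Solver.Ring.NaturalCoefficients.Default
    (CommutativeRing.commutativeSemiring commutativeRing)
  private
    module RingProperties = Algebra.Properties.Ring (CommutativeRing.ring commutativeRing)

  -1≡1 : - 1# ≡ 1#
  -1≡1 = trans (sym (fermat (- 1#))) (-1^2^[1+k]≡1 n)
    where
    -1^2^[1+k]≡1 : ∀ k → (- 1#) ^ (2 ℕ.^ suc k) ≡ 1#
    -1^2^[1+k]≡1 zero = begin
      - 1# * (- 1# * 1#) ≡⟨ cong (- 1# *_) (*-identityʳ (- 1#)) ⟩
      - 1# * - 1#        ≡⟨ RingProperties.-1*x≈-x (- 1#) ⟩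
      - - 1#             ≡⟨ RingProperties.-‿involutive 1# ⟩
      1#                 ∎
    -1^2^[1+k]≡1 (suc k) = begin
      (- 1#) ^ (2 ℕ.^ suc (suc k)) ≡⟨ x^2^[1+k]≡[x^2^k]² (- 1#) (suc k) ⟩
      ((- 1#) ^ (2 ℕ.^ suc k)) ²   ≡⟨ cong _² (-1^2^[1+k]≡1 k) ⟩
      1# ²                         ≡⟨ *-identityʳ 1# ⟩
      1#                           ∎

  1+1≡0 : 1# + 1# ≡ 0#
  1+1≡0 = trans (cong (1# +_) (sym -1≡1)) (-‿inverseʳ 1#)

  x+x≡0 : ∀ x → x + x ≡ 0#
  x+x≡0 x = begin
    x + x          ≡⟨ solve 1 (λ x → x :+ x := x :* (con 1 :+ con 1)) refl x ⟩
    x * (1# + 1#)  ≡⟨ cong (x *_) 1+1≡0 ⟩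
    x * 0#         ≡⟨ zeroʳ x ⟩
    0#             ∎

  x≡y+y⇒x≡0 : ∀ {x y} → x ≡ y + y → x ≡ 0#
  x≡y+y⇒x≡0 {y = y} x≡y+y = trans x≡y+y (x+x≡0 y)

  x+[y+y]≡x : ∀ x y → x + (y + y) ≡ x
  x+[y+y]≡x x y = trans (cong (x +_) (x+x≡0 y)) (+-identityʳ x)

  x+y≡0⇒x≡y : ∀ {x y} → x + y ≡ 0# → x ≡ y
  x+y≡0⇒x≡y {x} {y} x+y≡0 = begin
    x             ≡⟨ sym (x+[y+y]≡x x y) ⟩
    x + (y + y)   ≡⟨ sym (+-assoc x y y) ⟩
    (x + y) + y   ≡⟨ cong (_+ y) x+y≡0 ⟩
    0# + y        ≡⟨ +-identityˡ y ⟩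
    y             ∎

  x≡y⇒x+y≡0 : ∀ {x y} → x ≡ y → x + y ≡ 0#
  x≡y⇒x+y≡0 {x} refl = x+x≡0 x

  x≢y⇒x+y≢0 : ∀ {x y} → x ≢ y → x + y ≢ 0#
  x≢y⇒x+y≢0 x≢y = x≢y ∘′ x+y≡0⇒x≡y

  +-cancelˡ : ∀ {x y z} → x + y ≡ x + z → y ≡ z
  +-cancelˡ {x} {y} {z} x+y≡x+z = x+y≡0⇒x≡y (begin
    y + z               ≡⟨ sym (x+[y+y]≡x (y + z) x) ⟩
    (y + z) + (x + x)   ≡⟨ solve 3 (λ x y z → (y :+ z) :+ (x :+ x) := (x :+ y) :+ (x :+ z)) refl x y z ⟩
    (x + y) + (x + z)   ≡⟨ x≡y⇒x+y≡0 x+y≡x+z ⟩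
    0#                  ∎)

  [x+y]²≡x²+y² : ∀ x y → (x + y) ² ≡ x ² + y ²
  [x+y]²≡x²+y² x y = begin
    (x + y) ²
      ≡⟨ solve 2 (λ x y → (x :+ y) :* (x :+ y) := (x :* x :+ y :* y) :+ (x :* y :+ x :* y)) refl x y ⟩
    x ² + y ² + (x * y + x * y) ≡⟨ x+[y+y]≡x _ (x * y) ⟩
    x ² + y ²                   ∎

  x^2^k-distrib-+ : ∀ k x y → (x + y) ^ (2 ℕ.^ k) ≡ x ^ (2 ℕ.^ k) + y ^ (2 ℕ.^ k)
  x^2^k-distrib-+ zero    x y = distribʳ 1# x y
  x^2^k-distrib-+ (suc k) x y = begin
    (x + y) ^ (2 ℕ.^ suc k)                   ≡⟨ x^2^[1+k]≡[x^2^k]² (x + y) k ⟩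
    ((x + y) ^ (2 ℕ.^ k)) ²                   ≡⟨ cong _² (x^2^k-distrib-+ k x y) ⟩
    (x ^ (2 ℕ.^ k) + y ^ (2 ℕ.^ k)) ²         ≡⟨ [x+y]²≡x²+y² _ _ ⟩
    (x ^ (2 ℕ.^ k)) ² + (y ^ (2 ℕ.^ k)) ²
      ≡⟨ sym (cong₂ _+_ (x^2^[1+k]≡[x^2^k]² x k) (x^2^[1+k]≡[x^2^k]² y k)) ⟩
    x ^ (2 ℕ.^ suc k) + y ^ (2 ℕ.^ suc k)     ∎

  sqrt[x]²≡x : ∀ x → sqrt x ² ≡ x
  sqrt[x]²≡x x = trans (sym (x^2^[1+k]≡[x^2^k]² x n)) (fermat x)

  sqrt[x²]≡x : ∀ x → sqrt (x ²) ≡ x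
  sqrt[x²]≡x x = trans (^-distribʳ-* x x (2 ℕ.^ n)) (sqrt[x]²≡x x)

  ²-injective : ∀ {x y} → x ² ≡ y ² → x ≡ y
  ²-injective {x} {y} x²≡y² = trans (sym (sqrt[x²]≡x x)) (trans (cong sqrt x²≡y²) (sqrt[x²]≡x y))

  sqrt-distrib-+ : ∀ x y → sqrt (x + y) ≡ sqrt x + sqrt y
  sqrt-distrib-+ = x^2^k-distrib-+ n

  ⁴√ : F → F
  ⁴√ u = sqrt (sqrt u)

  ⁴√[u]⁴≡u : ∀ u → ⁴√ u ² ² ≡ u
  ⁴√[u]⁴≡u u = trans (cong _² (sqrt[x]²≡x (sqrt u))) (sqrt[x]²≡x u)

  ⁴√-root : ∀ {φ u} → u ≢ 0# → φ u ≡ 0# → ⁴√ u ≢ 0# × φ (⁴√ u ² ²) ≡ 0#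
  ⁴√-root {φ} {u} u≢0 φ[u]≡0 = ⁴√[u]≢0 , trans (cong φ (⁴√[u]⁴≡u u)) φ[u]≡0
    where
    ⁴√[u]≢0 : ⁴√ u ≢ 0#
    ⁴√[u]≢0 ⁴√[u]≡0 = u≢0 (begin
      u            ≡⟨ sym (⁴√[u]⁴≡u u) ⟩
      ⁴√ u ² ²     ≡⟨ cong (λ r → r ² ²) ⁴√[u]≡0 ⟩
      0# ² ²       ≡⟨ trans (cong _² (zeroˡ 0#)) (zeroˡ 0#) ⟩
      0#           ∎)

  x²≡x⇒x≡0⊎x≡1 : ∀ {x} → x ² ≡ x → x ≡ 0# ⊎ x ≡ 1#
  x²≡x⇒x≡0⊎x≡1 {x} x²≡x with x ≟ 0#
  ... | yes x≡0 = inj₁ x≡0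
  ... | no  x≢0 = inj₂ (x+y≡0⇒x≡y (x*y≡0⇒y≡0 x≢0 (begin
    x * (x + 1#) ≡⟨ solve 1 (λ x → x :* (x :+ con 1) := x :* x :+ x) refl x ⟩
    x ² + x      ≡⟨ x≡y⇒x+y≡0 x²≡x ⟩
    0#           ∎)))

  trAux-+ : ∀ k x y → trAux k (x + y) ≡ trAux k x + trAux k y
  trAux-+ zero    x y = sym (+-identityʳ 0#)
  trAux-+ (suc k) x y = begin
    (x + y) ^ (2 ℕ.^ k) + trAux k (x + y)
      ≡⟨ cong₂ _+_ (x^2^k-distrib-+ k x y) (trAux-+ k x y) ⟩
    (x ^ (2 ℕ.^ k) + y ^ (2 ℕ.^ k)) + (trAux k x + trAux k y)
      ≡⟨ solve 4 (λ a b c d → (a :+ b) :+ (c :+ d) := (a :+ c) :+ (b :+ d)) refl _ _ _ _ ⟩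
    (x ^ (2 ℕ.^ k) + trAux k x) + (y ^ (2 ℕ.^ k) + trAux k y) ∎

  trAux-² : ∀ k x → trAux k (x ²) ≡ trAux k x ²
  trAux-² zero    x = sym (zeroˡ 0#)
  trAux-² (suc k) x = begin
    (x ²) ^ (2 ℕ.^ k) + trAux k (x ²)      ≡⟨ cong₂ _+_ (^-distribʳ-* x x (2 ℕ.^ k)) (trAux-² k x) ⟩
    (x ^ (2 ℕ.^ k)) ² + trAux k x ²        ≡⟨ sym ([x+y]²≡x²+y² _ _) ⟩
    (x ^ (2 ℕ.^ k) + trAux k x) ²          ∎

  trAux[x]² : ∀ k x → trAux k x ² ≡ trAux k x + (x + x ^ (2 ℕ.^ k))
  trAux[x]² zero    x = begin
    0# ²             ≡⟨ zeroˡ 0# ⟩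
    0#               ≡⟨ sym (x+x≡0 x) ⟩
    x + x            ≡⟨ cong (x +_) (sym (*-identityʳ x)) ⟩
    x + x * 1#       ≡⟨ sym (+-identityˡ _) ⟩
    0# + (x + x * 1#) ∎
  trAux[x]² (suc k) x = begin
    (xᵏ + t) ²                ≡⟨ [x+y]²≡x²+y² xᵏ t ⟩
    xᵏ ² + t ²                ≡⟨ cong₂ _+_ (sym (x^2^[1+k]≡[x^2^k]² x k)) (trAux[x]² k x) ⟩
    xᵏ⁺¹ + (t + (x + xᵏ))
      ≡⟨ solve 4 (λ a t x b → a :+ (t :+ (x :+ b)) := (b :+ t) :+ (x :+ a)) refl xᵏ⁺¹ t x xᵏ ⟩
    (xᵏ + t) + (x + xᵏ⁺¹)     ∎
    where
    xᵏ = x ^ (2 ℕ.^ k)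
    xᵏ⁺¹ = x ^ (2 ℕ.^ suc k)
    t = trAux k x

  Tr-+ : ∀ x y → Tr (x + y) ≡ Tr x + Tr y
  Tr-+ = trAux-+ (suc n)

  Tr[x]²≡Tr[x] : ∀ x → Tr x ² ≡ Tr x
  Tr[x]²≡Tr[x] x = begin
    Tr x ²                   ≡⟨ trAux[x]² (suc n) x ⟩
    Tr x + (x + x ^ q)       ≡⟨ cong (λ y → Tr x + (x + y)) (fermat x) ⟩
    Tr x + (x + x)           ≡⟨ x+[y+y]≡x (Tr x) x ⟩
    Tr x                     ∎

  Tr[x²]≡Tr[x] : ∀ x → Tr (x ²) ≡ Tr x
  Tr[x²]≡Tr[x] x = trans (trAux-² (suc n) x) (Tr[x]²≡Tr[x] x)

  Tr[x²+x]≡0 : ∀ x → Tr (x ² + x) ≡ 0#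
  Tr[x²+x]≡0 x = trans (Tr-+ (x ²) x) (x≡y⇒x+y≡0 (Tr[x²]≡Tr[x] x))

  Tr≡0⊎Tr≡1 : ∀ x → Tr x ≡ 0# ⊎ Tr x ≡ 1#
  Tr≡0⊎Tr≡1 x = x²≡x⇒x≡0⊎x≡1 (Tr[x]²≡Tr[x] x)

  Tr[0]≡0 : Tr 0# ≡ 0#
  Tr[0]≡0 = trans (cong Tr (sym 0²+0≡0)) (Tr[x²+x]≡0 0#)
    where
    0²+0≡0 : 0# ² + 0# ≡ 0#
    0²+0≡0 = trans (+-identityʳ _) (zeroˡ 0#)

  odd⇒Tr[1]≡1 : suc n % 2 ≡ 1 → Tr 1# ≡ 1#
  odd⇒Tr[1]≡1 = trAux-odd-1 (suc n)
    where
    trAux-odd-1 : ∀ k → k % 2 ≡ 1 → trAux k 1# ≡ 1#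
    trAux-odd-1 (suc zero)    _   = trans (+-identityʳ _) (*-identityʳ 1#)
    trAux-odd-1 (suc (suc k)) odd = begin
      1# ^ (2 ℕ.^ suc k) + (1# ^ (2 ℕ.^ k) + trAux k 1#)
        ≡⟨ cong₂ (λ a b → a + (b + trAux k 1#)) (1^a≡1 (2 ℕ.^ suc k)) (1^a≡1 (2 ℕ.^ k)) ⟩
      1# + (1# + trAux k 1#)   ≡⟨ sym (+-assoc 1# 1# _) ⟩
      (1# + 1#) + trAux k 1#   ≡⟨ cong (_+ trAux k 1#) 1+1≡0 ⟩
      0# + trAux k 1#          ≡⟨ +-identityˡ _ ⟩
      trAux k 1#               ≡⟨ trAux-odd-1 k odd ⟩
      1#                       ∎

  Additive : (F → F) → Set
  Additive φ = ∀ x y → φ (x + y) ≡ φ x + φ y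

  AtMostOneNonzeroRoot : (F → F) → Set
  AtMostOneNonzeroRoot φ = ∀ {u v} → u ≢ 0# → v ≢ 0# → φ u ≡ 0# → φ v ≡ 0# → u ≡ v

  additive-noThreeEqualValues : ∀ {φ} → Additive φ → AtMostOneNonzeroRoot φ →
    ∀ {a b c} → a ≢ b → a ≢ c → b ≢ c → φ a ≡ φ b → φ a ≡ φ c → ⊥
  additive-noThreeEqualValues {φ} additive atMostOne {a} {b} {c} a≢b a≢c b≢c φa≡φb φa≡φc =
    b≢c (+-cancelˡ (atMostOne (x≢y⇒x+y≢0 a≢b) (x≢y⇒x+y≢0 a≢c) (root φa≡φb) (root φa≡φc)))
    where
    root : ∀ {d} → φ a ≡ φ d → φ (a + d) ≡ 0#
    root {d} φa≡φd = trans (additive a d) (x≡y⇒x+y≡0 φa≡φd)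

  additive-injective : ∀ {φ} → Additive φ → (∀ {u} → u ≢ 0# → φ u ≢ 0#) →
    ∀ {a b} → φ a ≡ φ b → a ≡ b
  additive-injective {φ} additive noRoot {a} {b} φa≡φb with a ≟ b
  ... | yes a≡b = a≡b
  ... | no  a≢b = ⊥-elim (noRoot (x≢y⇒x+y≢0 a≢b) (trans (additive a b) (x≡y⇒x+y≡0 φa≡φb)))

module LineHyperoval {n : ℕ} (K : FiniteField (suc n))
  (Tr[1]≡1 : FiniteField.Tr K (FiniteField.1# K) ≡ FiniteField.1# K) where
  open FiniteField K
  open FieldProperties K
  open Characteristic2 K
  open IsCommutativeRing isCommutativeRing
    using (+-identityˡ; +-identityʳ; *-identityʳ; zeroˡ; distribˡ)
  open ≡-Reasoning
  open import Algebra.Solver.Ring.NaturalCoefficients.Default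
    (CommutativeRing.commutativeSemiring commutativeRing)

  ∘-distribˡ-+ : ∀ x a b → x ∘ (a + b) ≡ x ∘ a + x ∘ b
  ∘-distribˡ-+ x a b = begin
    x * (a + b) + Tr x * sqrt (a + b) + Tr (x ^ 2 * (a + b))
      ≡⟨ cong₂ (λ r t → x * (a + b) + Tr x * r + t) (sqrt-distrib-+ a b)
               (trans (cong Tr (distribˡ (x ^ 2) a b)) (Tr-+ _ _)) ⟩
    x * (a + b) + Tr x * (sqrt a + sqrt b) + (Tr (x ^ 2 * a) + Tr (x ^ 2 * b))
      ≡⟨ solve 8 (λ x a b t ra rb ta tb → x :* (a :+ b) :+ t :* (ra :+ rb) :+ (ta :+ tb)
                  := (x :* a :+ t :* ra :+ ta) :+ (x :* b :+ t :* rb :+ tb))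
               refl x a b (Tr x) (sqrt a) (sqrt b) _ _ ⟩
    x ∘ a + x ∘ b ∎

  0∘x≡0 : ∀ x → 0# ∘ x ≡ 0#
  0∘x≡0 x = begin
    0# * x + Tr 0# * sqrt x + Tr (0# ^ 2 * x)
      ≡⟨ cong₂ (λ t r → 0# * x + t * sqrt x + Tr r) Tr[0]≡0
               (solve 1 (λ x → con 0 :* (con 0 :* con 1) :* x := con 0) refl x) ⟩
    0# * x + 0# * sqrt x + Tr 0#
      ≡⟨ cong (0# * x + 0# * sqrt x +_) Tr[0]≡0 ⟩
    0# * x + 0# * sqrt x + 0#
      ≡⟨ solve 2 (λ x r → con 0 :* x :+ con 0 :* r :+ con 0 := con 0) refl x (sqrt x) ⟩
    0#                                        ∎

  -- The line ℒc (inj₁ m) = l_{slope m , m} meets l∞ in the point (slope m)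
  -- and the vertical line l_x in the affine point (x , ordinate x m).
  slope : F → F
  slope m = m + sqrt m

  ordinate : F → F → F
  ordinate x m = x ∘ slope m + m

  slope-additive : Additive slope
  slope-additive a b = begin
    (a + b) + sqrt (a + b)         ≡⟨ cong ((a + b) +_) (sqrt-distrib-+ a b) ⟩
    (a + b) + (sqrt a + sqrt b)
      ≡⟨ solve 4 (λ a b c d → (a :+ b) :+ (c :+ d) := (a :+ c) :+ (b :+ d)) refl a b (sqrt a) (sqrt b) ⟩
    slope a + slope b              ∎

  ordinate-additive : ∀ x → Additive (ordinate x)
  ordinate-additive x a b = begin
    x ∘ slope (a + b) + (a + b)               ≡⟨ cong (λ r → x ∘ r + (a + b)) (slope-additive a b) ⟩
    x ∘ (slope a + slope b) + (a + b)         ≡⟨ cong (_+ (a + b)) (∘-distribˡ-+ x (slope a) (slope b)) ⟩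
    (x ∘ slope a + x ∘ slope b) + (a + b)
      ≡⟨ solve 4 (λ a b c d → (a :+ b) :+ (c :+ d) := (a :+ c) :+ (b :+ d)) refl _ _ a b ⟩
    ordinate x a + ordinate x b               ∎

  slope-atMostOneNonzeroRoot : AtMostOneNonzeroRoot slope
  slope-atMostOneNonzeroRoot u≢0 v≢0 slope[u]≡0 slope[v]≡0 =
    trans (root≡1 u≢0 slope[u]≡0) (sym (root≡1 v≢0 slope[v]≡0))
    where
    root≡1 : ∀ {u} → u ≢ 0# → slope u ≡ 0# → u ≡ 1#
    root≡1 {u} u≢0 slope[u]≡0 with x²≡x⇒x≡0⊎x≡1 (trans (cong _² (x+y≡0⇒x≡y slope[u]≡0)) (sqrt[x]²≡x u))
    ... | inj₁ u≡0 = ⊥-elim (u≢0 u≡0)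
    ... | inj₂ u≡1 = u≡1

  ordinate[0]≡id : ∀ m → ordinate 0# m ≡ m
  ordinate[0]≡id m = trans (cong (_+ m) (0∘x≡0 (slope m))) (+-identityˡ m)

  ε : F → F → F
  ε x s = Tr (x * s ² + x * s)

  ordinate-fourthPower : ∀ x s →
    ordinate x (s ² ²) ≡ x * (s ² ² + s ²) + Tr x * (s ² + s) + ε x s + s ² ²
  ordinate-fourthPower x s = begin
    x ∘ (s ² ² + sqrt (s ² ²)) + s ² ²      ≡⟨ cong (λ r → x ∘ (s ² ² + r) + s ² ²) (sqrt[x²]≡x (s ²)) ⟩
    x * (s ² ² + s ²) + Tr x * sqrt (s ² ² + s ²) + Tr (x ^ 2 * (s ² ² + s ²)) + s ² ²
      ≡⟨ cong₂ (λ r t → x * (s ² ² + s ²) + Tr x * r + t + s ² ²) sqrt[s⁴+s²]≡s²+s Tr[x²[s⁴+s²]]≡ε ⟩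
    x * (s ² ² + s ²) + Tr x * (s ² + s) + ε x s + s ² ² ∎
    where
    sqrt[s⁴+s²]≡s²+s : sqrt (s ² ² + s ²) ≡ s ² + s
    sqrt[s⁴+s²]≡s²+s = trans (sqrt-distrib-+ (s ² ²) (s ²)) (cong₂ _+_ (sqrt[x²]≡x (s ²)) (sqrt[x²]≡x s))

    Tr[x²[s⁴+s²]]≡ε : Tr (x ^ 2 * (s ² ² + s ²)) ≡ ε x s
    Tr[x²[s⁴+s²]]≡ε = begin
      Tr (x ^ 2 * (s ² ² + s ²))
        ≡⟨ cong Tr (solve 2 (λ x s → (x :* (x :* con 1)) :* ((s :* s) :* (s :* s) :+ s :* s)
                                     := (x :* (s :* s)) :* (x :* (s :* s)) :+ (x :* s) :* (x :* s)) refl x s) ⟩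
      Tr ((x * s ²) ² + (x * s) ²)        ≡⟨ Tr-+ _ _ ⟩
      Tr ((x * s ²) ²) + Tr ((x * s) ²)   ≡⟨ cong₂ _+_ (Tr[x²]≡Tr[x] _) (Tr[x²]≡Tr[x] _) ⟩
      Tr (x * s ²) + Tr (x * s)           ≡⟨ sym (Tr-+ _ _) ⟩
      ε x s                               ∎

  ε≡Tr[x[x+1]s²] : ∀ x s → ε x s ≡ Tr (x * ((x + 1#) * s ²))
  ε≡Tr[x[x+1]s²] x s = begin
    Tr (x * s ² + x * s)             ≡⟨ Tr-+ _ _ ⟩
    Tr (x * s ²) + Tr (x * s)        ≡⟨ cong (Tr (x * s ²) +_) (sym (Tr[x²]≡Tr[x] (x * s))) ⟩
    Tr (x * s ²) + Tr ((x * s) ²)    ≡⟨ sym (Tr-+ _ _) ⟩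
    Tr (x * s ² + (x * s) ²)         ≡⟨ cong Tr (solve 2 (λ x s → x :* (s :* s) :+ (x :* s) :* (x :* s)
                                                           := x :* ((x :+ con 1) :* (s :* s))) refl x s) ⟩
    Tr (x * ((x + 1#) * s ²))        ∎

  Tr[x]≡0⇒Tr[x+1]≡1 : ∀ {x} → Tr x ≡ 0# → Tr (x + 1#) ≡ 1#
  Tr[x]≡0⇒Tr[x+1]≡1 {x} Tr[x]≡0 = trans (Tr-+ x 1#) (trans (cong₂ _+_ Tr[x]≡0 Tr[1]≡1) (+-identityˡ 1#))

  Tr[x]≡1⇒Tr[x+1]≡0 : ∀ {x} → Tr x ≡ 1# → Tr (x + 1#) ≡ 0#
  Tr[x]≡1⇒Tr[x+1]≡0 {x} Tr[x]≡1 = trans (Tr-+ x 1#) (trans (cong₂ _+_ Tr[x]≡1 Tr[1]≡1) 1+1≡0)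

  x+1≢0 : ∀ {x} → Tr x ≡ 0# → x + 1# ≢ 0#
  x+1≢0 {x} Tr[x]≡0 x+1≡0 = 1≢0 (trans (sym Tr[1]≡1) (trans (cong Tr (sym (x+y≡0⇒x≡y x+1≡0))) Tr[x]≡0))

  -- z² + x z + (x + 1) = (z + 1) (z + x + 1), so z is 1 or x + 1.
  z²+xz≡x+1⇒Tr[z]≡1 : ∀ {x z} → Tr x ≡ 0# → z ² + x * z ≡ x + 1# → Tr z ≡ 1#
  z²+xz≡x+1⇒Tr[z]≡1 {x} {z} Tr[x]≡0 z²+xz≡x+1 with z + 1# ≟ 0#
  ... | yes z+1≡0 = trans (cong Tr (x+y≡0⇒x≡y z+1≡0)) Tr[1]≡1
  ... | no  z+1≢0 = trans (cong Tr (x+y≡0⇒x≡y (x*y≡0⇒y≡0 z+1≢0 (begin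
    (z + 1#) * (z + (x + 1#))          ≡⟨ solve 2 (λ z x → (z :+ con 1) :* (z :+ (x :+ con 1))
                                                := (z :* z :+ x :* z :+ (x :+ con 1)) :+ (z :+ z)) refl z x ⟩
    (z ² + x * z + (x + 1#)) + (z + z) ≡⟨ x+[y+y]≡x _ z ⟩
    z ² + x * z + (x + 1#)             ≡⟨ x≡y⇒x+y≡0 z²+xz≡x+1 ⟩
    0#                                 ∎)))) (Tr[x]≡0⇒Tr[x+1]≡1 Tr[x]≡0)

  -- With z = (x + 1) s², the hypothesis reads z² + x z = x + 1, and ε x s = Tr (x z).
  [x+1]s⁴+xs²≡1⇒ε≡0 : ∀ {x s} → Tr x ≡ 0# → (x + 1#) * s ² ² + x * s ² ≡ 1# → ε x s ≡ 0#
  [x+1]s⁴+xs²≡1⇒ε≡0 {x} {s} Tr[x]≡0 [x+1]s⁴+xs²≡1 = begin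
    ε x s                  ≡⟨ ε≡Tr[x[x+1]s²] x s ⟩
    Tr (x * z)             ≡⟨ cong Tr xz≡z²+x+1 ⟩
    Tr (z ² + (x + 1#))    ≡⟨ Tr-+ _ _ ⟩
    Tr (z ²) + Tr (x + 1#) ≡⟨ cong₂ _+_ (trans (Tr[x²]≡Tr[x] z) (z²+xz≡x+1⇒Tr[z]≡1 Tr[x]≡0 z²+xz≡x+1))
                                        (Tr[x]≡0⇒Tr[x+1]≡1 Tr[x]≡0) ⟩
    1# + 1#                ≡⟨ 1+1≡0 ⟩
    0#                     ∎
    where
    z = (x + 1#) * s ²

    z²+xz≡x+1 : z ² + x * z ≡ x + 1#
    z²+xz≡x+1 = begin
      z ² + x * z
        ≡⟨ solve 2 (λ x s → let z = (x :+ con 1) :* (s :* s) in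
             z :* z :+ x :* z := (x :+ con 1) :* ((x :+ con 1) :* ((s :* s) :* (s :* s)) :+ x :* (s :* s))) refl x s ⟩
      (x + 1#) * ((x + 1#) * s ² ² + x * s ²)  ≡⟨ cong ((x + 1#) *_) [x+1]s⁴+xs²≡1 ⟩
      (x + 1#) * 1#                            ≡⟨ *-identityʳ _ ⟩
      x + 1#                                   ∎

    xz≡z²+x+1 : x * z ≡ z ² + (x + 1#)
    xz≡z²+x+1 = x+y≡0⇒x≡y (begin
      x * z + (z ² + (x + 1#))
        ≡⟨ solve 3 (λ x z w → x :* z :+ (z :* z :+ w) := (z :* z :+ x :* z) :+ w) refl x z (x + 1#) ⟩
      (z ² + x * z) + (x + 1#)  ≡⟨ x≡y⇒x+y≡0 z²+xz≡x+1 ⟩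
      0#                        ∎)

  ordinate-fourthPower-Tr0 : ∀ {x} s → Tr x ≡ 0# →
    ordinate x (s ² ²) ≡ ((x + 1#) * s ² ² + x * s ²) + ε x s
  ordinate-fourthPower-Tr0 {x} s Tr[x]≡0 = begin
    ordinate x (s ² ²)
      ≡⟨ ordinate-fourthPower x s ⟩
    x * (s ² ² + s ²) + Tr x * (s ² + s) + ε x s + s ² ²
      ≡⟨ cong (λ t → x * (s ² ² + s ²) + t * (s ² + s) + ε x s + s ² ²) Tr[x]≡0 ⟩
    x * (s ² ² + s ²) + 0# * (s ² + s) + ε x s + s ² ²
      ≡⟨ solve 4 (λ x s² s e → x :* (s² :* s² :+ s²) :+ con 0 :* (s² :+ s) :+ e :+ s² :* s²
                               := (x :+ con 1) :* (s² :* s²) :+ x :* s² :+ e) refl x (s ²) s (ε x s) ⟩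
    ((x + 1#) * s ² ² + x * s ²) + ε x s
      ∎

  ordinate-root-Tr0 : ∀ {x s} → Tr x ≡ 0# → s ≢ 0# → ordinate x (s ² ²) ≡ 0# → (x + 1#) * s ² ≡ x
  ordinate-root-Tr0 {x} {s} Tr[x]≡0 s≢0 root = byε (Tr≡0⊎Tr≡1 (x * s ² + x * s))
    where
    Q≡ε : (x + 1#) * s ² ² + x * s ² ≡ ε x s
    Q≡ε = x+y≡0⇒x≡y (trans (sym (ordinate-fourthPower-Tr0 s Tr[x]≡0)) root)

    byε : ε x s ≡ 0# ⊎ ε x s ≡ 1# → (x + 1#) * s ² ≡ x
    byε (inj₁ ε≡0) = x+y≡0⇒x≡y (x*y≡0⇒y≡0 (x*y≢0 s≢0 s≢0) (begin
      s ² * ((x + 1#) * s ² + x)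
        ≡⟨ solve 2 (λ x s → (s :* s) :* ((x :+ con 1) :* (s :* s) :+ x)
                             := (x :+ con 1) :* ((s :* s) :* (s :* s)) :+ x :* (s :* s)) refl x s ⟩
      (x + 1#) * s ² ² + x * s ²     ≡⟨ Q≡ε ⟩
      ε x s                          ≡⟨ ε≡0 ⟩
      0#                             ∎))
    byε (inj₂ ε≡1) = ⊥-elim (1≢0 (trans (sym ε≡1) ([x+1]s⁴+xs²≡1⇒ε≡0 Tr[x]≡0 (trans Q≡ε ε≡1))))

  quartic : F → F → F
  quartic y s = y * s ² ² + (y * s ² + s)

  ordinate-fourthPower-Tr1 : ∀ {x} s → Tr x ≡ 1# → ordinate x (s ² ²) ≡ quartic (x + 1#) s + ε x s
  ordinate-fourthPower-Tr1 {x} s Tr[x]≡1 = begin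
    ordinate x (s ² ²)
      ≡⟨ ordinate-fourthPower x s ⟩
    x * (s ² ² + s ²) + Tr x * (s ² + s) + ε x s + s ² ²
      ≡⟨ cong (λ t → x * (s ² ² + s ²) + t * (s ² + s) + ε x s + s ² ²) Tr[x]≡1 ⟩
    x * (s ² ² + s ²) + 1# * (s ² + s) + ε x s + s ² ²
      ≡⟨ solve 4 (λ x s² s e → x :* (s² :* s² :+ s²) :+ con 1 :* (s² :+ s) :+ e :+ s² :* s²
                               := (x :+ con 1) :* (s² :* s²) :+ ((x :+ con 1) :* s² :+ s) :+ e) refl x (s ²) s (ε x s) ⟩
    quartic (x + 1#) s + ε x s
      ∎

  [x+e]²≡x²+e : ∀ x {e} → e ² ≡ e → (x + e) ² ≡ x ² + e
  [x+e]²≡x²+e x {e} e²≡e = trans ([x+y]²≡x²+y² x e) (cong (x ² +_) e²≡e)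

  quartic-shift : ∀ y s {e} → e ² ≡ e → quartic y (s + e) ≡ quartic y s + e
  quartic-shift y s {e} e²≡e = begin
    y * (s + e) ² ² + (y * (s + e) ² + (s + e))
      ≡⟨ cong (λ r → y * r ² + (y * r + (s + e))) ([x+e]²≡x²+e s e²≡e) ⟩
    y * (s ² + e) ² + (y * (s ² + e) + (s + e))
      ≡⟨ cong (λ r → y * r + (y * (s ² + e) + (s + e))) ([x+e]²≡x²+e (s ²) e²≡e) ⟩
    y * (s ² ² + e) + (y * (s ² + e) + (s + e))
      ≡⟨ solve 4 (λ y s s² e → y :* (s² :* s² :+ e) :+ (y :* (s² :+ e) :+ (s :+ e))
                               := (y :* (s² :* s²) :+ (y :* s² :+ s) :+ e) :+ (y :* e :+ y :* e)) refl y s (s ²) e ⟩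
    (quartic y s + e) + (y * e + y * e)
      ≡⟨ x+[y+y]≡x _ (y * e) ⟩
    quartic y s + e
      ∎

  ε-shift : ∀ x s {e} → e ² ≡ e → ε x (s + e) ≡ ε x s
  ε-shift x s {e} e²≡e = cong Tr (begin
    x * (s + e) ² + x * (s + e)
      ≡⟨ cong (λ r → x * r + x * (s + e)) ([x+e]²≡x²+e s e²≡e) ⟩
    x * (s ² + e) + x * (s + e)
      ≡⟨ solve 4 (λ x s s² e → x :* (s² :+ e) :+ x :* (s :+ e)
                               := (x :* s² :+ x :* s) :+ (x :* e :+ x :* e)) refl x s (s ²) e ⟩
    (x * s ² + x * s) + (x * e + x * e)
      ≡⟨ x+[y+y]≡x _ (x * e) ⟩
    x * s ² + x * s
      ∎)

  ε[x,0]≡0 : ∀ x → ε x 0# ≡ 0#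
  ε[x,0]≡0 x = trans (cong Tr (solve 1 (λ x → x :* (con 0 :* con 0) :+ x :* con 0 := con 0) refl x)) Tr[0]≡0

  -- Shifting s by the idempotent ε x s absorbs the trace term into a root of the quartic,
  -- and ε x is unchanged by the shift, so s is recovered from that root.
  ordinate-root-Tr1 : ∀ {x s} → Tr x ≡ 1# → s ≢ 0# → ordinate x (s ² ²) ≡ 0# →
    ∃ λ σ → σ ≢ 0# × quartic (x + 1#) σ ≡ 0# × s ≡ σ + ε x σ
  ordinate-root-Tr1 {x} {s} Tr[x]≡1 s≢0 root = σ , σ≢0 , quartic[σ]≡0 , s≡σ+ε[σ]
    where
    e = ε x s
    e²≡e : e ² ≡ e
    e²≡e = Tr[x]²≡Tr[x] _
    σ = s + e

    quartic[σ]≡0 : quartic (x + 1#) σ ≡ 0#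
    quartic[σ]≡0 = trans (quartic-shift (x + 1#) s e²≡e)
      (trans (sym (ordinate-fourthPower-Tr1 s Tr[x]≡1)) root)

    s≡σ+ε[σ] : s ≡ σ + ε x σ
    s≡σ+ε[σ] = begin
      s              ≡⟨ sym (x+[y+y]≡x s e) ⟩
      s + (e + e)    ≡⟨ solve 2 (λ s e → s :+ (e :+ e) := (s :+ e) :+ e) refl s e ⟩
      σ + e          ≡⟨ cong (σ +_) (sym (ε-shift x s e²≡e)) ⟩
      σ + ε x σ      ∎

    σ≢0 : σ ≢ 0#
    σ≢0 σ≡0 = s≢0 (begin
      s              ≡⟨ s≡σ+ε[σ] ⟩
      σ + ε x σ      ≡⟨ cong (λ r → r + ε x r) σ≡0 ⟩
      0# + ε x 0#    ≡⟨ cong (0# +_) (ε[x,0]≡0 x) ⟩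
      0# + 0#        ≡⟨ +-identityʳ 0# ⟩
      0#             ∎)

  quartic-root : ∀ {y a} → a ≢ 0# → quartic y a ≡ 0# → y * (a * (a ² + 1#)) ≡ 1#
  quartic-root {y} {a} a≢0 root = x+y≡0⇒x≡y (x*y≡0⇒y≡0 a≢0 (begin
    a * (y * (a * (a ² + 1#)) + 1#) ≡⟨ solve 2 (λ y a → a :* (y :* (a :* (a :* a :+ con 1)) :+ con 1)
                                                 := y :* ((a :* a) :* (a :* a)) :+ (y :* (a :* a) :+ a)) refl y a ⟩
    quartic y a                     ≡⟨ root ⟩
    0#                              ∎))

  a[a²+1]≡b[b²+1]⇒a²+ab+b²≡1 : ∀ {a b} → a ≢ b → a * (a ² + 1#) ≡ b * (b ² + 1#) → a ² + a * b + b ² ≡ 1#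
  a[a²+1]≡b[b²+1]⇒a²+ab+b²≡1 {a} {b} a≢b a[a²+1]≡b[b²+1] =
    x+y≡0⇒x≡y (x*y≡0⇒y≡0 (x≢y⇒x+y≢0 a≢b) (x≡y+y⇒x≡0 (begin
      (a + b) * (a ² + a * b + b ² + 1#)
        ≡⟨ solve 2 (λ a b → let w = a :* a :* b :+ a :* (b :* b) in
             (a :+ b) :* ((a :* a :+ a :* b :+ b :* b) :+ con 1)
             := (a :* (a :* a :+ con 1) :+ b :* (b :* b :+ con 1)) :+ w :+ w) refl a b ⟩
      (a * (a ² + 1#) + b * (b ² + 1#)) + w + w
        ≡⟨ cong (λ r → r + w + w) (x≡y⇒x+y≡0 a[a²+1]≡b[b²+1]) ⟩
      0# + w + w
        ≡⟨ cong (_+ w) (+-identityˡ w) ⟩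
      w + w
        ∎)))
    where
    w = a ² * b + a * b ²

  a²+ab+b²≡1⇒a[a²+1]≡ab[a+b] : ∀ {a b} → a ² + a * b + b ² ≡ 1# → a * (a ² + 1#) ≡ a * b * (a + b)
  a²+ab+b²≡1⇒a[a²+1]≡ab[a+b] {a} {b} a²+ab+b²≡1 = begin
    a * (a ² + 1#)                         ≡⟨ cong (λ d → a * (a ² + d)) (sym a²+ab+b²≡1) ⟩
    a * (a ² + (a ² + a * b + b ²))        ≡⟨ solve 2 (λ a b → a :* (a :* a :+ (a :* a :+ a :* b :+ b :* b))
                                                := a :* b :* (a :+ b) :+ (a :* a :* a :+ a :* a :* a)) refl a b ⟩
    a * b * (a + b) + (a ² * a + a ² * a)  ≡⟨ x+[y+y]≡x _ (a ² * a) ⟩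
    a * b * (a + b)                        ∎

  -- After substituting D = 1 and t = 1 the difference is y² times a polynomial in a, b
  -- whose coefficients are all even.
  y²≡v²+v+1 : ∀ {y a b} → a ² + a * b + b ² ≡ 1# → y * (a * b * (a + b)) ≡ 1# →
    let v = y * (a ² * a + a * b ² + b ² * b) in y ² ≡ v ² + v + 1#
  y²≡v²+v+1 {y} {a} {b} D≡1 t≡1 = x+y≡0⇒x≡y (begin
    y ² + (v ² + v + 1#)
      ≡⟨ solve 2 (λ y v → y :* y :+ (v :* v :+ v :+ con 1)
                          := y :* y :* (con 1 :* con 1 :* con 1) :+ (v :* v :+ v :* con 1 :+ con 1 :* con 1)) refl y v ⟩
    y ² * (1# * 1# * 1#) + (v ² + v * 1# + 1# * 1#)
      ≡⟨ cong₂ (λ d r → y ² * (d * d * d) + (v ² + v * r + r * r)) (sym D≡1) (sym t≡1) ⟩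
    y ² * (D * D * D) + (v ² + v * t + t * t)
      ≡⟨ x≡y+y⇒x≡0 (solve 3 (λ y a b →
        let D = a :* a :+ a :* b :+ b :* b
            v = y :* ((a :* a) :* a :+ a :* (b :* b) :+ (b :* b) :* b)
            t = y :* (a :* b :* (a :+ b))
            Z = y :* y :* (a :^ 6 :+ con 2 :* a :^ 5 :* b :+ con 5 :* a :^ 4 :* b :^ 2 :+ con 6 :* a :^ 3 :* b :^ 3
                           :+ con 5 :* a :^ 2 :* b :^ 4 :+ con 3 :* a :* b :^ 5 :+ b :^ 6)
        in y :* y :* (D :* D :* D) :+ (v :* v :+ v :* t :+ t :* t) := Z :+ Z) refl y a b) ⟩
    0#
      ∎)
    where
    D = a ² + a * b + b ²
    t = y * (a * b * (a + b))
    v = y * (a ² * a + a * b ² + b ² * b)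

  quartic-twoNonzeroRoots⇒Tr≡1 : ∀ {y a b} → a ≢ 0# → b ≢ 0# → a ≢ b →
    quartic y a ≡ 0# → quartic y b ≡ 0# → Tr y ≡ 1#
  quartic-twoNonzeroRoots⇒Tr≡1 {y} {a} {b} a≢0 b≢0 a≢b root-a root-b = begin
    Tr y                   ≡⟨ sym (Tr[x²]≡Tr[x] y) ⟩
    Tr (y ²)
      ≡⟨ cong Tr (y²≡v²+v+1 D≡1 (trans (cong (y *_) (sym (a²+ab+b²≡1⇒a[a²+1]≡ab[a+b] D≡1))) ya[a²+1]≡1)) ⟩
    Tr (v ² + v + 1#)      ≡⟨ Tr-+ _ _ ⟩
    Tr (v ² + v) + Tr 1#   ≡⟨ cong₂ _+_ (Tr[x²+x]≡0 v) Tr[1]≡1 ⟩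
    0# + 1#                ≡⟨ +-identityˡ 1# ⟩
    1#                     ∎
    where
    v = y * (a ² * a + a * b ² + b ² * b)
    ya[a²+1]≡1 : y * (a * (a ² + 1#)) ≡ 1#
    ya[a²+1]≡1 = quartic-root a≢0 root-a

    yb[b²+1]≡1 : y * (b * (b ² + 1#)) ≡ 1#
    yb[b²+1]≡1 = quartic-root b≢0 root-b

    y≢0 : y ≢ 0#
    y≢0 y≡0 = 1≢0 (trans (sym ya[a²+1]≡1) (trans (cong (_* (a * (a ² + 1#))) y≡0) (zeroˡ _)))

    D≡1 : a ² + a * b + b ² ≡ 1#
    D≡1 = a[a²+1]≡b[b²+1]⇒a²+ab+b²≡1 a≢b (*-cancelˡ y≢0 (trans ya[a²+1]≡1 (sym yb[b²+1]≡1)))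

  quartic-atMostOneNonzeroRoot : ∀ {y} → Tr y ≡ 0# → AtMostOneNonzeroRoot (quartic y)
  quartic-atMostOneNonzeroRoot {y} Tr[y]≡0 {a} {b} a≢0 b≢0 root-a root-b with a ≟ b
  ... | yes a≡b = a≡b
  ... | no  a≢b =
    ⊥-elim (1≢0 (trans (sym (quartic-twoNonzeroRoots⇒Tr≡1 a≢0 b≢0 a≢b root-a root-b)) Tr[y]≡0))

  ordinate-fourthPower-atMostOneNonzeroRoot : ∀ x {s t} → s ≢ 0# → t ≢ 0# →
    ordinate x (s ² ²) ≡ 0# → ordinate x (t ² ²) ≡ 0# → s ≡ t
  ordinate-fourthPower-atMostOneNonzeroRoot x {s} {t} s≢0 t≢0 root-s root-t =
    [ viaTr0 , viaTr1 ]′ (Tr≡0⊎Tr≡1 x)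
    where
    viaTr0 : Tr x ≡ 0# → s ≡ t
    viaTr0 Tr[x]≡0 = ²-injective (*-cancelˡ (x+1≢0 Tr[x]≡0)
      (trans (ordinate-root-Tr0 Tr[x]≡0 s≢0 root-s) (sym (ordinate-root-Tr0 Tr[x]≡0 t≢0 root-t))))

    viaTr1 : Tr x ≡ 1# → s ≡ t
    viaTr1 Tr[x]≡1 =
      let σ , σ≢0 , root-σ , s≡σ+ε[σ] = ordinate-root-Tr1 Tr[x]≡1 s≢0 root-s
          τ , τ≢0 , root-τ , t≡τ+ε[τ] = ordinate-root-Tr1 Tr[x]≡1 t≢0 root-t
          σ≡τ = quartic-atMostOneNonzeroRoot (Tr[x]≡1⇒Tr[x+1]≡0 Tr[x]≡1) σ≢0 τ≢0 root-σ root-τ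
      in trans s≡σ+ε[σ] (trans (cong (λ r → r + ε x r) σ≡τ) (sym t≡τ+ε[τ]))

  ordinate-atMostOneNonzeroRoot : ∀ x → AtMostOneNonzeroRoot (ordinate x)
  ordinate-atMostOneNonzeroRoot x {u} {v} u≢0 v≢0 root-u root-v =
    let s≢0 , root-s = ⁴√-root {ordinate x} u≢0 root-u
        t≢0 , root-t = ⁴√-root {ordinate x} v≢0 root-v
    in begin
    u          ≡⟨ sym (⁴√[u]⁴≡u u) ⟩
    ⁴√ u ² ²   ≡⟨ cong (λ r → r ² ²) (ordinate-fourthPower-atMostOneNonzeroRoot x s≢0 t≢0 root-s root-t) ⟩
    ⁴√ v ² ²   ≡⟨ ⁴√[u]⁴≡u v ⟩
    v          ∎

  ordinate[1]-noNonzeroRoot : ∀ {u} → u ≢ 0# → ordinate 1# u ≢ 0#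
  ordinate[1]-noNonzeroRoot u≢0 root-u =
    let s≢0 , root-s = ⁴√-root {ordinate 1#} u≢0 root-u
        σ , σ≢0 , root-σ , _ = ordinate-root-Tr1 Tr[1]≡1 s≢0 root-s
    in σ≢0 (trans (sym (quartic[0]≡id σ)) (trans (cong (λ y → quartic y σ) (sym 1+1≡0)) root-σ))
    where
    quartic[0]≡id : ∀ σ → quartic 0# σ ≡ σ
    quartic[0]≡id = solve 1 (λ σ → con 0 :* ((σ :* σ) :* (σ :* σ)) :+ (con 0 :* (σ :* σ) :+ σ) := σ) refl

  noThree-slopeLines : ∀ P {a b c} → a ≢ b → a ≢ c → b ≢ c →
    P ∈L ℒc (inj₁ a) → P ∈L ℒc (inj₁ b) → P ∈L ℒc (inj₁ c) → ⊥
  noThree-slopeLines (affine x y) a≢b a≢c b≢c y≡a y≡b y≡c =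
    additive-noThreeEqualValues (ordinate-additive x) (ordinate-atMostOneNonzeroRoot x)
      a≢b a≢c b≢c (trans (sym y≡a) y≡b) (trans (sym y≡a) y≡c)
  noThree-slopeLines (atInf nothing)  _ _ _ () _ _
  noThree-slopeLines (atInf (just m)) a≢b a≢c b≢c m≡a m≡b m≡c =
    additive-noThreeEqualValues slope-additive slope-atMostOneNonzeroRoot
      a≢b a≢c b≢c (trans (sym m≡a) m≡b) (trans (sym m≡a) m≡c)

  noThree-vertical-slopeLines : ∀ P i {a b} → a ≢ b →
    P ∈L ℒc (inj₂ i) → P ∈L ℒc (inj₁ a) → P ∈L ℒc (inj₁ b) → ⊥
  noThree-vertical-slopeLines (affine _ y) zero {a} {b} a≢b refl y≡a y≡b = a≢b (begin
    a              ≡⟨ sym (ordinate[0]≡id a) ⟩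
    ordinate 0# a  ≡⟨ trans (sym y≡a) y≡b ⟩
    ordinate 0# b  ≡⟨ ordinate[0]≡id b ⟩
    b              ∎)
  noThree-vertical-slopeLines (affine _ y) (suc zero) a≢b refl y≡a y≡b =
    a≢b (additive-injective (ordinate-additive 1#) ordinate[1]-noNonzeroRoot (trans (sym y≡a) y≡b))
  noThree-vertical-slopeLines (atInf nothing)  _          _ _  () _
  noThree-vertical-slopeLines (atInf (just _)) zero       _ () _  _
  noThree-vertical-slopeLines (atInf (just _)) (suc zero) _ () _  _

  noThree-verticals-slopeLine : ∀ P i j m → i ≢ j →
    P ∈L ℒc (inj₂ i) → P ∈L ℒc (inj₂ j) → P ∈L ℒc (inj₁ m) → ⊥
  noThree-verticals-slopeLine P                zero       zero       _ i≢j _    _ _  = i≢j refl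
  noThree-verticals-slopeLine P                (suc zero) (suc zero) _ i≢j _    _ _  = i≢j refl
  noThree-verticals-slopeLine (affine _ _)     zero       (suc zero) _ _   refl 0≡1 _ = 1≢0 (sym 0≡1)
  noThree-verticals-slopeLine (affine _ _)     (suc zero) zero       _ _   refl 1≡0 _ = 1≢0 1≡0
  noThree-verticals-slopeLine (atInf nothing)  _          _          _ _   _    _ ()
  noThree-verticals-slopeLine (atInf (just _)) zero       _          _ _   ()   _ _
  noThree-verticals-slopeLine (atInf (just _)) (suc zero) _          _ _   ()   _ _

  Fin2-noThreeDistinct : ∀ (i j k : Fin 2) → i ≢ j → j ≢ k → i ≢ k → ⊥
  Fin2-noThreeDistinct zero       zero       _          i≢j _   _   = i≢j refl
  Fin2-noThreeDistinct (suc zero) (suc zero) _          i≢j _   _   = i≢j refl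
  Fin2-noThreeDistinct zero       (suc zero) zero       _   _   i≢k = i≢k refl
  Fin2-noThreeDistinct zero       (suc zero) (suc zero) _   j≢k _   = j≢k refl
  Fin2-noThreeDistinct (suc zero) zero       zero       _   j≢k _   = j≢k refl
  Fin2-noThreeDistinct (suc zero) zero       (suc zero) _   _   i≢k = i≢k refl

  ℒc-noThree : ∀ i j k → i ≢ j → j ≢ k → i ≢ k →
    ¬ Σ Point (λ P → P ∈L ℒc i × P ∈L ℒc j × P ∈L ℒc k)
  ℒc-noThree (inj₁ a) (inj₁ b) (inj₁ c) i≢j j≢k i≢k (P , Pi , Pj , Pk) =
    noThree-slopeLines P (i≢j ∘′ cong inj₁) (i≢k ∘′ cong inj₁) (j≢k ∘′ cong inj₁) Pi Pj Pk
  ℒc-noThree (inj₂ i) (inj₁ b) (inj₁ c) _ j≢k _ (P , Pi , Pj , Pk) =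
    noThree-vertical-slopeLines P i (j≢k ∘′ cong inj₁) Pi Pj Pk
  ℒc-noThree (inj₁ a) (inj₂ j) (inj₁ c) _ _ i≢k (P , Pi , Pj , Pk) =
    noThree-vertical-slopeLines P j (i≢k ∘′ cong inj₁) Pj Pi Pk
  ℒc-noThree (inj₁ a) (inj₁ b) (inj₂ k) i≢j _ _ (P , Pi , Pj , Pk) =
    noThree-vertical-slopeLines P k (i≢j ∘′ cong inj₁) Pk Pi Pj
  ℒc-noThree (inj₂ i) (inj₂ j) (inj₁ c) i≢j _ _ (P , Pi , Pj , Pk) =
    noThree-verticals-slopeLine P i j c (i≢j ∘′ cong inj₂) Pi Pj Pk
  ℒc-noThree (inj₂ i) (inj₁ b) (inj₂ k) _ _ i≢k (P , Pi , Pj , Pk) =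
    noThree-verticals-slopeLine P i k b (i≢k ∘′ cong inj₂) Pi Pk Pj
  ℒc-noThree (inj₁ a) (inj₂ j) (inj₂ k) _ j≢k _ (P , Pi , Pj , Pk) =
    noThree-verticals-slopeLine P j k a (j≢k ∘′ cong inj₂) Pj Pk Pi
  ℒc-noThree (inj₂ i) (inj₂ j) (inj₂ k) i≢j j≢k i≢k _ =
    Fin2-noThreeDistinct i j k (i≢j ∘′ cong inj₂) (j≢k ∘′ cong inj₂) (i≢k ∘′ cong inj₂)

  lV-injective : ∀ {a b} → lV a ≡ lV b → a ≡ b
  lV-injective refl = refl

  ℒc-injective : Injective _≡_ _≡_ ℒc
  ℒc-injective {inj₁ a}          {inj₁ b}          refl = refl
  ℒc-injective {inj₂ zero}       {inj₂ zero}       _    = refl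
  ℒc-injective {inj₂ (suc zero)} {inj₂ (suc zero)} _    = refl
  ℒc-injective {inj₂ zero}       {inj₂ (suc zero)} 0≡1  = ⊥-elim (1≢0 (sym (lV-injective 0≡1)))
  ℒc-injective {inj₂ (suc zero)} {inj₂ zero}       1≡0  = ⊥-elim (1≢0 (lV-injective 1≡0))
  ℒc-injective {inj₁ _}          {inj₂ zero}       ()
  ℒc-injective {inj₁ _}          {inj₂ (suc zero)} ()
  ℒc-injective {inj₂ zero}       {inj₁ _}          ()
  ℒc-injective {inj₂ (suc zero)} {inj₁ _}          ()

  ℒc-size : (F ⊎ Fin 2) ⤖ Fin (2 ℕ.^ suc n ℕ.+ 2)
  ℒc-size = ↔⇒⤖ (↔-sym (Finₚ.+↔⊎ {2 ℕ.^ suc n} {2}) ↔-∘ (card↔ ⊎-↔ ↔-id (Fin 2)))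

  ℒc-isLineHyperoval : IsLineHyperoval ℒc
  ℒc-isLineHyperoval = record { size = ℒc-size ; distinct = ℒc-injective ; noThree = ℒc-noThree }

corollary3p4 : (n : ℕ) → n % 2 ≡ 1 → (K : FiniteField n) →
               FiniteField.IsLineHyperoval K (FiniteField.ℒc K)
corollary3p4 zero    ()
corollary3p4 (suc n) odd K = LineHyperoval.ℒc-isLineHyperoval K (Characteristic2.odd⇒Tr[1]≡1 K odd)
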